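{- Let $(P,\le,{}',0,1)$ be a Boolean poset satisfying the Ascending Chain Condition and the Descending Chain Condition, let $T(x,y,z):=\operatorname{Min}U\big(\operatorname{Max}L(x,z),\operatorname{Max}L(x,y',z'),\operatorname{Max}L(x',y',z)\big)$ for $x,y,z\in P$, and let $\Theta$ be a reflexive binary relation on $P$ which is compatible with the binary operators $\operatorname{Max}L$ and $\operatorname{Min}U$ and with the unary operation $'$. Then $\Theta$ is a congruence on $(P,\le,{}',0,1)$.
   Context: For a poset $(P,\le)$ and $A\subseteq P$ let $L(A)=\{x\mid x\le y\ \forall y\in A\}$, $U(A)=\{x\mid y\le x\ \forall y\in A\}$; write $L(x,y)=L(\{x,y\})$, $L(x,y,z)$, $U(A,B,C)=U(A\cup B\cup C)$, $LU(A)=L(U(A))$, etc.; $\operatorname{Max}A$, $\operatorname{Min}A$ are the sets of maximal, minimal elements. A poset is distributive if $L(U(x,y),z)=LU(L(x,z),L(y,z))$ for all $x,y,z$. A complementation on a bounded poset $(P,\le,0,1)$ is a unary operation $'$ with $U(x,x')=\{1\}$ and $L(x,x')=\{0\}$; a Boolean poset is a distributive bounded poset with a complementation. A binary relation $R$ is compatible with a map $Q\colon P^2\to2^P$ if whenever $(a_1,b_1),(a_2,b_2)\in R$ there exist $a\in Q(a_1,a_2)$, $b\in Q(b_1,b_2)$ with $(a,b)\in R$; it is compatible with $'$ if $(a,b)\in R$ implies $(a',b')\in R$. A congruence on a Boolean poset is an equivalence relation compatible with $(x,y)\mapsto\operatorname{Max}L(x,y)$, $(x,y)\mapsto\operatorname{Min}U(x,y)$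 and $'$. -}

module Defs where

open import Data.Product using (Σ; _×_; _,_; ∃)
open import Data.Sum using (_⊎_)
open import Relation.Binary.PropositionalEquality using (_≡_; _≢_)
open import Relation.Binary.Structures using (IsEquivalence)
open import Induction.WellFounded using (WellFounded)

Subset : Set → Set₁
Subset P = P → Set

_≐_ : {P : Set} → Subset P → Subset P → Set
A ≐ B = ∀ w → (A w → B w) × (B w → A w)

infixr 20 _∪_
_∪_ : {P : Set} → Subset P → Subset P → Subset P
(A ∪ B) w = A w ⊎ B w

sing : {P : Set} → P → Subset P
sing x w = w ≡ x

pair : {P : Set} → P → P → Subset P
pair x y w = w ≡ x ⊎ w ≡ y

triple : {P : Set} → P → P → P → Subset P
triple x y z w = w ≡ x ⊎ w ≡ y ⊎ w ≡ z

record BoundedPoset : Set₁ where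
  field
    Carrier  : Set
    _≤_      : Carrier → Carrier → Set
    ≤-refl   : ∀ x → x ≤ x
    ≤-trans  : ∀ {x y z} → x ≤ y → y ≤ z → x ≤ z
    ≤-antisym : ∀ {x y} → x ≤ y → y ≤ x → x ≡ y
    𝟘        : Carrier
    𝟙        : Carrier
    𝟘-least  : ∀ x → 𝟘 ≤ x
    𝟙-greatest : ∀ x → x ≤ 𝟙

  _<_ : Carrier → Carrier → Set
  x < y = x ≤ y × x ≢ y

  L : Subset Carrier → Subset Carrier
  L A x = ∀ y → A y → x ≤ y

  U : Subset Carrier → Subset Carrier
  U A x = ∀ y → A y → y ≤ x

  Max : Subset Carrier → Subset Carrier
  Max A x = A x × (∀ y → A y → x ≤ y → y ≡ x)

  Min : Subset Carrier → Subset Carrier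
  Min A x = A x × (∀ y → A y → y ≤ x → y ≡ x)

  MaxL : Carrier → Carrier → Subset Carrier
  MaxL x y = Max (L (pair (x) (y)))

  MinU : Carrier → Carrier → Subset Carrier
  MinU x y = Min (U (pair (x) (y)))

  Distributive : Set
  Distributive = ∀ x y z →
    L (U (pair (x) (y)) ∪ (sing z)) ≐ L (U (L (pair (x) (z)) ∪ L (pair (y) (z))))

  IsComplementation : (Carrier → Carrier) → Set
  IsComplementation c = ∀ x →
    (U (pair (x) (c x)) ≐ (sing 𝟙)) × (L (pair (x) (c x)) ≐ (sing 𝟘))

  ACC : Set
  ACC = WellFounded (λ x y → y < x)

  DCC : Set
  DCC = WellFounded _<_

record BooleanPoset : Set₁ where
  field
    poset : BoundedPoset
  open BoundedPoset poset public
  field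
    distributive : Distributive
    _′           : Carrier → Carrier
    complementation : IsComplementation _′

  T : Carrier → Carrier → Carrier → Subset Carrier
  T x y z = Min (U (MaxL x z ∪ Max (L (triple (x) (y ′) (z ′))) ∪ Max (L (triple (x ′) (y ′) (z)))))

CompatibleWith : {P : Set} → (P → P → Set) → (P → P → Subset P) → Set
CompatibleWith {P} R Q = ∀ {a₁ b₁ a₂ b₂} → R a₁ b₁ → R a₂ b₂ →
  Σ P λ a → Σ P λ b → Q a₁ a₂ a × Q b₁ b₂ b × R a b

CompatibleWith₁ : {P : Set} → (P → P → Set) → (P → P) → Set
CompatibleWith₁ R f = ∀ {a b} → R a b → R (f a) (f b)

Reflexive : {P : Set} → (P → P → Set) → Set
Reflexive R = ∀ x → R x x

IsCongruence : (B : BooleanPoset) → (BooleanPoset.Carrier B → BooleanPoset.Carrier B → Set) → Set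
IsCongruence B Θ =
  IsEquivalence Θ × CompatibleWith Θ MaxL × CompatibleWith Θ MinU × CompatibleWith₁ Θ _′
  where open BooleanPoset B

{-# OPTIONS --safe #-}
module Submission where

-- Symmetry: let a Θ b. By ACC pick m maximal with b Θ m. Compatibility with
-- Min U forces m above every e with v Θ e for some v ≤ b: in particular above
-- L(b), and above every e with 𝟘 Θ e. Compatibility with Max L (and ′) puts
-- every lower bound of {b′, a} into the class of 𝟘, so distributivity,
-- L(a) = L(U(b, b′), a) = LU(L(b, a), L(b′, a)), gives a ≤ m. Symmetrically
-- there is n Θ a with b ≤ n, and Max L(b, n) = {b}, Max L(m, a) = {a} give
-- b Θ a.
-- Transitivity is the same argument, splitting along both a and b.

open import Defs
open import Axiom.ExcludedMiddle using (ExcludedMiddle)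
open import Axiom.DoubleNegationElimination using (em⇒dne)
open import Level using (0ℓ)
open import Data.Product using (∃; _×_; _,_; proj₁; proj₂)
open import Data.Sum using (inj₁; inj₂)
open import Function.Base using (flip)
open import Induction.WellFounded using (Acc; acc)
open import Relation.Nullary using (yes; no)
open import Relation.Binary.PropositionalEquality using (_≡_; refl; sym; subst; subst₂)
open import Relation.Binary.Structures using (IsEquivalence)

flip-compatible : ∀ {P : Set} {R : P → P → Set} {Q : P → P → Subset P} →
  CompatibleWith R Q → CompatibleWith (flip R) Q
flip-compatible compatible r₁ r₂ with compatible r₁ r₂
... | a , b , a∈Q , b∈Q , rab = b , a , b∈Q , a∈Q , rab

module Cones (P : BoundedPoset) where
  open BoundedPoset P

  lower-pair : ∀ {x y w} → w ≤ x → w ≤ y → L (pair x y) w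
  lower-pair w≤x w≤y _ (inj₁ refl) = w≤x
  lower-pair w≤x w≤y _ (inj₂ refl) = w≤y

  lower-pairˡ : ∀ {x y w} → L (pair x y) w → w ≤ x
  lower-pairˡ w∈L = w∈L _ (inj₁ refl)

  lower-pairʳ : ∀ {x y w} → L (pair x y) w → w ≤ y
  lower-pairʳ w∈L = w∈L _ (inj₂ refl)

  upper-pair : ∀ {x y w} → x ≤ w → y ≤ w → U (pair x y) w
  upper-pair x≤w y≤w _ (inj₁ refl) = x≤w
  upper-pair x≤w y≤w _ (inj₂ refl) = y≤w

  upper-pairˡ : ∀ {x y w} → U (pair x y) w → x ≤ w
  upper-pairˡ w∈U = w∈U _ (inj₁ refl)

  upper-pairʳ : ∀ {x y w} → U (pair x y) w → y ≤ w
  upper-pairʳ w∈U = w∈U _ (inj₂ refl)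

  MaxL≡ˡ : ∀ {x y w} → x ≤ y → MaxL x y w → w ≡ x
  MaxL≡ˡ {x} x≤y (w∈L , maximal) =
    sym (maximal x (lower-pair (≤-refl x) x≤y) (lower-pairˡ w∈L))

  MaxL≡ʳ : ∀ {x y w} → y ≤ x → MaxL x y w → w ≡ y
  MaxL≡ʳ {y = y} y≤x (w∈L , maximal) =
    sym (maximal y (lower-pair y≤x (≤-refl y)) (lower-pairʳ w∈L))

  MinU≡ˡ : ∀ {x y w} → y ≤ x → MinU x y w → w ≡ x
  MinU≡ˡ {x} y≤x (w∈U , minimal) =
    sym (minimal x (upper-pair (≤-refl x) y≤x) (upper-pairˡ w∈U))

  Max-inhabited : ExcludedMiddle 0ℓ → ACC → (C : Subset Carrier) → ∀ {t} → C t → ∃ (Max C)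
  Max-inhabited lem ascending C {t} t∈C = climb (ascending t) t∈C
    where
    climb : ∀ {t} → Acc (λ x y → y < x) t → C t → ∃ (Max C)
    climb {t} (acc above) t∈C with lem {∃ λ y → C y × t < y}
    ... | yes (y , y∈C , t<y) = climb (above t<y) y∈C
    ... | no ∄bigger = t , t∈C , λ y y∈C t≤y →
      em⇒dne lem λ y≢t → ∄bigger (y , y∈C , t≤y , λ t≡y → y≢t (sym t≡y))

module Complements (B : BooleanPoset) where
  open BooleanPoset B
  open Cones poset

  ≡𝟘-if-≤-complement : ∀ {x w} → w ≤ x → w ≤ (x ′) → w ≡ 𝟘
  ≡𝟘-if-≤-complement w≤x w≤x′ = proj₁ (proj₂ (complementation _) _) (lower-pair w≤x w≤x′)

  ≤-by-complement-split : ∀ x {z t} →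
    (∀ {e} → L (pair x z) e → e ≤ t) → (∀ {e} → L (pair (x ′) z) e → e ≤ t) → z ≤ t
  ≤-by-complement-split x {z} {t} below below′ =
    proj₁ (distributive x (x ′) z z) z∈LHS t t∈U
    where
    z∈LHS : L (U (pair x (x ′)) ∪ sing z) z
    z∈LHS y (inj₁ y∈U) = subst (z ≤_) (sym (proj₁ (proj₁ (complementation x) y) y∈U)) (𝟙-greatest z)
    z∈LHS y (inj₂ refl) = ≤-refl z
    t∈U : U (L (pair x z) ∪ L (pair (x ′) z)) t
    t∈U y (inj₁ y∈L) = below y∈L
    t∈U y (inj₂ y∈L) = below′ y∈L

module Compatible
  (lem : ExcludedMiddle 0ℓ) (B : BooleanPoset) (ascending : BooleanPoset.ACC B)
  {R : BooleanPoset.Carrier B → BooleanPoset.Carrier B → Set}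
  (reflexive : Reflexive R) (MaxL-compatible : CompatibleWith R (BooleanPoset.MaxL B))
  (MinU-compatible : CompatibleWith R (BooleanPoset.MinU B))
  (′-compatible : CompatibleWith₁ R (BooleanPoset._′ B))
  where
  open BooleanPoset B
  open Cones poset
  open Complements B

  𝟘-related-if-disjoint : ∀ {x y f} → R x y → f ≤ y → (∀ {p} → p ≤ x → p ≤ f → p ≡ 𝟘) → R 𝟘 f
  𝟘-related-if-disjoint {f = f} r f≤y disjoint with MaxL-compatible r (reflexive f)
  ... | p , q , (p∈L , _) , q∈MaxL , rpq =
    subst₂ R (disjoint (lower-pairˡ p∈L) (lower-pairʳ p∈L)) (MaxL≡ʳ f≤y q∈MaxL) rpq

  𝟘-related : ∀ {x y f} → R x y → f ≤ (x ′) → f ≤ y → R 𝟘 f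
  𝟘-related r f≤x′ f≤y = 𝟘-related-if-disjoint r f≤y
    λ p≤x p≤f → ≡𝟘-if-≤-complement p≤x (≤-trans p≤f f≤x′)

  𝟘-related′ : ∀ {x y f} → R x y → f ≤ x → f ≤ (y ′) → R 𝟘 f
  𝟘-related′ r f≤x f≤y′ = 𝟘-related-if-disjoint (′-compatible r) f≤y′
    λ p≤x′ p≤f → ≡𝟘-if-≤-complement (≤-trans p≤f f≤x) p≤x′

  Max-absorbs : ∀ {u m v e} → Max (R u) m → v ≤ u → R v e → e ≤ m
  Max-absorbs {e = e} (rum , maximal) v≤u rve with MinU-compatible rum rve
  ... | x , y , x∈MinU , (y∈U , _) , rxy =
    subst (e ≤_) (maximal y ruy (upper-pairˡ y∈U)) (upper-pairʳ y∈U)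
    where
    ruy : R _ y
    ruy = subst (λ w → R w y) (MinU≡ˡ v≤u x∈MinU) rxy

  squeeze : ∀ {a b r t} → R b t → R r a → b ≤ r → a ≤ t → R b a
  squeeze rbt rra b≤r a≤t with MaxL-compatible rbt rra
  ... | x , y , x∈MaxL , y∈MaxL , rxy = subst₂ R (MaxL≡ˡ b≤r x∈MaxL) (MaxL≡ʳ a≤t y∈MaxL) rxy

  sym-step : ∀ {a b} → R a b → ∃ λ m → R b m × a ≤ m
  sym-step {b = b} r with Max-inhabited lem ascending (R b) (reflexive b)
  ... | m , m-max = m , proj₁ m-max , ≤-by-complement-split b
    (λ e∈L → absorb (lower-pairˡ e∈L) (reflexive _))
    (λ e∈L → absorb (𝟘-least b) (𝟘-related′ r (lower-pairʳ e∈L) (lower-pairˡ e∈L)))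
    where
    absorb : ∀ {v e} → v ≤ b → R v e → e ≤ m
    absorb = Max-absorbs m-max

  trans-step : ∀ {a b c} → R a b → R b c → ∃ λ m → R a m × c ≤ m
  trans-step {a} {b} rab rbc with Max-inhabited lem ascending (R a) (reflexive a)
  ... | m , m-max = m , proj₁ m-max , ≤-by-complement-split a
    (λ e∈L → absorb (lower-pairˡ e∈L) (reflexive _))
    (λ e∈L → ≤-by-complement-split b
      (λ f∈L → absorb (𝟘-least a)
        (𝟘-related rab (≤-trans (lower-pairʳ f∈L) (lower-pairˡ e∈L)) (lower-pairˡ f∈L)))
      (λ f∈L → absorb (𝟘-least a)
        (𝟘-related rbc (lower-pairˡ f∈L) (≤-trans (lower-pairʳ f∈L) (lower-pairʳ e∈L)))))
    where
    absorb : ∀ {v e} → v ≤ a → R v e → e ≤ m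
    absorb = Max-absorbs m-max

module Congruence
  (lem : ExcludedMiddle 0ℓ) (B : BooleanPoset) (ascending : BooleanPoset.ACC B)
  {R : BooleanPoset.Carrier B → BooleanPoset.Carrier B → Set}
  (reflexive : Reflexive R) (MaxL-compatible : CompatibleWith R (BooleanPoset.MaxL B))
  (MinU-compatible : CompatibleWith R (BooleanPoset.MinU B))
  (′-compatible : CompatibleWith₁ R (BooleanPoset._′ B))
  where
  open Compatible lem B ascending reflexive MaxL-compatible MinU-compatible ′-compatible
  module Flipped = Compatible lem B ascending {flip R} reflexive
    (flip-compatible MaxL-compatible) (flip-compatible MinU-compatible) ′-compatible

  symmetric : ∀ {a b} → R a b → R b a
  symmetric r with sym-step r | Flipped.sym-step r
  ... | m , rbm , a≤m | n , rna , b≤n = squeeze rbm rna b≤n a≤m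

  transitive : ∀ {a b c} → R a b → R b c → R a c
  transitive rab rbc with trans-step rab rbc | Flipped.trans-step rbc rab
  ... | m , ram , c≤m | n , rnc , a≤n = squeeze ram rnc a≤n c≤m

  isEquivalence : IsEquivalence R
  isEquivalence = record { refl = reflexive _ ; sym = symmetric ; trans = transitive }

theorem5p5 : ExcludedMiddle 0ℓ → (B : BooleanPoset) →
    BoundedPoset.ACC (BooleanPoset.poset B) → BoundedPoset.DCC (BooleanPoset.poset B) →
    (Θ : BooleanPoset.Carrier B → BooleanPoset.Carrier B → Set) →
    Reflexive Θ → CompatibleWith Θ (BooleanPoset.MaxL B) →
    CompatibleWith Θ (BooleanPoset.MinU B) → CompatibleWith₁ Θ (BooleanPoset._′ B) →
    IsCongruence B Θ
theorem5p5 lem B ascending _ Θ reflexive MaxL-compatible MinU-compatible ′-compatible =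
  isEquivalence , MaxL-compatible , MinU-compatible , ′-compatible
  where
  open Congruence lem B ascending reflexive MaxL-compatible MinU-compatible ′-compatible
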